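{- For every integer $n\ge 4$, $px_{3,2}(K_n)=2$.
   Context: All graphs are finite, simple and undirected; edge-colorings need not be proper. In an edge-colored graph, a tree $T$ is a proper tree if no two adjacent edges of $T$ receive the same color. For a connected graph $G$ and $S\subseteq V(G)$ with $|S|\ge 2$, an $S$-tree is a tree in $G$ containing all vertices of $S$. $S$-trees $T_1,\dots,T_\ell$ are internally disjoint if $E(T_i)\cap E(T_j)=\emptyset$ and $V(T_i)\cap V(T_j)=S$ for all $i\ne j$. For a $k$-subset $S$, $\kappa(S)$ is the maximum number of internally disjoint $S$-trees in $G$, and $\kappa_k(G)=\min\{\kappa(S): S\subseteq V(G),|S|=k\}$. For integers $2\le k\le |V(G)|$ and $1\le \ell\le \kappa_k(G)$, the $(k,\ell)$-proper index $px_{k,\ell}(G)$ is the minimum number of colors in an edge-coloring of $G$ such that for every $k$-subset $S$ of $V(G)$ there exist $\ell$ internally disjoint proper $S$-trees. $K_n$ denotes the complete graph on $n$ vertices. -}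

module Defs where

open import Data.Nat using (ℕ; zero; suc; _≤_; _<_)
open import Data.Fin using (Fin; zero; suc; inject₁; fromℕ)
open import Data.Bool using (Bool; true; false)
open import Data.Product using (Σ; _×_; _,_)
open import Data.Sum using (_⊎_)
open import Relation.Binary.PropositionalEquality using (_≡_; _≢_)
open import Relation.Nullary using (¬_)
open import Function.Definitions using (Injective)

-- The complete graph K_n has vertex set Fin n and every pair of distinct
-- vertices is an edge.

-- An edge-coloring of K_n with k colors: a symmetric function on pairs of
-- vertices (values on the diagonal u = u are irrelevant, as no such edge exists).
record Coloring (k n : ℕ) : Set where
  field
    col : Fin n → Fin n → Fin k
    col-sym : ∀ u v → col u v ≡ col v u
open Coloring public

record Subgraph (n : ℕ) : Set where
  field
    V : Fin n → Bool
    E : Fin n → Fin n → Bool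
    E-sym : ∀ u v → E u v ≡ E v u
    E-irr : ∀ u → E u u ≡ false
    E-V : ∀ u v → E u v ≡ true → V u ≡ true
open Subgraph public

data Walk {n : ℕ} (H : Subgraph n) : Fin n → Fin n → Set where
  here : ∀ {u} → Walk H u u
  step : ∀ {u v w} → E H u v ≡ true → Walk H v w → Walk H u w

Connected : ∀ {n} → Subgraph n → Set
Connected {n} H = ∀ (u v : Fin n) → V H u ≡ true → V H v ≡ true → Walk H u v

-- A cycle in H: distinct vertices f 0, …, f m (m ≥ 2, i.e. at least 3
-- vertices) with f i f (i+1) an edge for all i < m, and f m f 0 an edge.
Cycle : ∀ {n} → Subgraph n → Set
Cycle {n} H =
  Σ ℕ λ m → Σ (Fin (suc m) → Fin n) λ f →
    Injective _≡_ _≡_ f × (2 ≤ m) ×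
    (∀ (i : Fin m) → E H (f (inject₁ i)) (f (suc i)) ≡ true) ×
    (E H (f (fromℕ m)) (f zero) ≡ true)

IsTree : ∀ {n} → Subgraph n → Set
IsTree H = Connected H × ¬ Cycle H

IsProper : ∀ {k n} → Coloring k n → Subgraph n → Set
IsProper {n = n} c H =
  ∀ (u v w : Fin n) → E H u v ≡ true → E H u w ≡ true → v ≢ w →
    col c u v ≢ col c u w

InS : ∀ {n} → Fin n → Fin n → Fin n → Fin n → Set
InS a b c x = (x ≡ a) ⊎ (x ≡ b) ⊎ (x ≡ c)

IsSTree : ∀ {n} → Fin n → Fin n → Fin n → Subgraph n → Set
IsSTree a b c H = IsTree H × V H a ≡ true × V H b ≡ true × V H c ≡ true

-- internally disjoint (w.r.t. S = {a,b,c}): edge-disjoint and the common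
-- vertices are exactly S (S is contained in both since they are S-trees).
InternallyDisjoint : ∀ {n} → Fin n → Fin n → Fin n → Subgraph n → Subgraph n → Set
InternallyDisjoint {n} a b c H₁ H₂ =
  (∀ (u v : Fin n) → E H₁ u v ≡ true → E H₂ u v ≡ false) ×
  (∀ (x : Fin n) → V H₁ x ≡ true → V H₂ x ≡ true → InS a b c x)

Good32 : ∀ {k n} → Coloring k n → Set
Good32 {n = n} col =
  ∀ (a b c : Fin n) → a ≢ b → a ≢ c → b ≢ c →
    Σ (Subgraph n) λ T₁ → Σ (Subgraph n) λ T₂ →
      IsSTree a b c T₁ × IsSTree a b c T₂ ×
      IsProper col T₁ × IsProper col T₂ ×
      InternallyDisjoint a b c T₁ T₂

px32-K≡ : ℕ → ℕ → Set
px32-K≡ n k =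
  (Σ (Coloring k n) Good32) × (∀ j → j < k → ¬ (Σ (Coloring j n) Good32))

-- Colour K_{4+m} as follows: on four core vertices 0,1,2,3 the red edges form the path
-- 0-3-2-1, the edges among the m extra vertices are red, and all other edges are blue.
-- The colouring only sees which vertices are extra, so every triple S lies in a
-- colour-preserving copy of K_{4+k}, k ≤ 3, whose extra vertices all belong to S; there two
-- internally disjoint proper paths through S are listed explicitly and checked by evaluation,
-- and images of trees under embeddings are trees.  A path on distinct vertices is a tree
-- because the position along it is an injective potential changing by one along every edge.
-- One colour is not enough: a proper tree in one colour has maximum degree one, so it has at
-- most two vertices.

module Submission where

open import Defs
open import Data.Nat using (ℕ; zero; suc; _+_; _^_; _≤_; _<_; _≡ᵇ_; z≤n; s≤s)
import Data.Nat.Properties as ℕ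
open import Data.Fin using (Fin; zero; suc; inject₁; fromℕ; toℕ; splitAt; join; _↑ˡ_; _↑ʳ_; #_)
open import Data.Fin.Properties
  using (_≟_; any?; all?; ¬Fin0; splitAt-join; join-splitAt; splitAt-↑ˡ; splitAt-↑ʳ; splitAt⁻¹-↑ˡ; splitAt⁻¹-↑ʳ)
open import Data.Bool using (true; false; if_then_else_)
import Data.Bool.Properties as Bool
open import Data.List using (List; []; _∷_; findᵇ)
open import Data.List.Relation.Unary.Any using (here; there)
open import Data.List.Relation.Unary.All as All using (_∷_)
open import Data.List.Relation.Unary.AllPairs as AllPairs using (_∷_)
open import Data.List.Relation.Unary.Unique.Propositional using (Unique)
open import Data.List.Membership.Propositional using (_∈_)
open import Data.Vec using (Vec; []; _∷_; lookup)
open import Data.Vec.Relation.Unary.All using ([]; _∷_)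
open import Data.Vec.Relation.Unary.AllPairs using ([]; _∷_)
import Data.Vec.Relation.Unary.Unique.Propositional as VecUnique
open import Data.Vec.Relation.Unary.Unique.Propositional.Properties using (lookup-injective)
open import Data.Maybe using (maybe)
open import Data.Product using (Σ; ∃; ∃₂; _×_; _,_; proj₁; proj₂)
open import Data.Sum using (_⊎_; inj₁; inj₂)
import Data.Sum as Sum
open import Data.Sum.Properties using (inj₁-injective; inj₂-injective)
open import Data.Empty using (⊥-elim)
open import Function using (id; _∘_)
open import Function.Bundles using (mk⇔)
open import Function.Definitions using (Injective)
open import Relation.Binary.PropositionalEquality
open import Relation.Nullary using (Dec; yes; no; does; ¬_; ¬?; contradiction)
open import Relation.Nullary.Decidable
  using (_×-dec_; _⊎-dec_; _→-dec_; dec-true; dec-false; does-⇔; toWitness)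

-- Walks and acyclicity

module _ {n} {H : Subgraph n} where

  edge-sym : ∀ {u v} → E H u v ≡ true → E H v u ≡ true
  edge-sym {u} {v} e = trans (E-sym H v u) e

  _◅◅_ : ∀ {u v w} → Walk H u v → Walk H v w → Walk H u w
  here ◅◅ q = q
  step e p ◅◅ q = step e (p ◅◅ q)

  reverse : ∀ {u v} → Walk H u v → Walk H v u
  reverse here = here
  reverse (step e p) = reverse p ◅◅ step (edge-sym e) here

walk-map : ∀ {n K} {G : Subgraph K} {H : Subgraph n} (f : Fin K → Fin n) →
           (∀ u v → E G u v ≡ true → E H (f u) (f v) ≡ true) →
           ∀ {u v} → Walk G u v → Walk H (f u) (f v)
walk-map f f-edge here = here
walk-map f f-edge (step e p) = step (f-edge _ _ e) (walk-map f f-edge p)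

witness : ∀ {a} {A : Set a} (a? : Dec A) → does a? ≡ true → A
witness (yes a) _ = a

Consecutive : ℕ → ℕ → Set
Consecutive i j = i ≡ suc j ⊎ j ≡ suc i


module Zigzag (g : ℕ → ℕ) (m : ℕ)
  (unit-step : ∀ {t} → t < m → Consecutive (g t) (g (suc t)))
  (no-backtrack : ∀ {t} → 2 + t ≤ m → g (2 + t) ≢ g t) where

  private
    rises : g 1 ≡ suc (g 0) → ∀ {t} → t < m → g (suc t) ≡ suc (g t)
    rises up {zero} _ = up
    rises up {suc t} t<m with unit-step t<m
    ... | inj₂ rise = rise
    ... | inj₁ fall = ⊥-elim (no-backtrack t<m (ℕ.suc-injective
                        (trans (sym fall) (rises up (ℕ.<-trans (ℕ.n<1+n t) t<m)))))

    falls : g 0 ≡ suc (g 1) → ∀ {t} → t < m → g t ≡ suc (g (suc t))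
    falls down {zero} _ = down
    falls down {suc t} t<m with unit-step t<m
    ... | inj₁ fall = fall
    ... | inj₂ rise = ⊥-elim (no-backtrack t<m
                        (trans rise (sym (falls down (ℕ.<-trans (ℕ.n<1+n t) t<m)))))

    risen : g 1 ≡ suc (g 0) → ∀ {t} → t ≤ m → g t ≡ t + g 0
    risen up {zero} _ = refl
    risen up {suc t} t<m = trans (rises up t<m) (cong suc (risen up (ℕ.<⇒≤ t<m)))

    fallen : g 0 ≡ suc (g 1) → ∀ {t} → t ≤ m → g 0 ≡ t + g t
    fallen down {zero} _ = refl
    fallen down {suc t} t<m = begin
      g 0                 ≡⟨ fallen down (ℕ.<⇒≤ t<m) ⟩
      t + g t             ≡⟨ cong (t +_) (falls down t<m) ⟩
      t + suc (g (suc t)) ≡⟨ ℕ.+-suc t _ ⟩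
      suc t + g (suc t)   ∎
      where open ≡-Reasoning

  monotone : 0 < m → (g m ≡ m + g 0) ⊎ (g 0 ≡ m + g m)
  monotone 0<m with unit-step 0<m
  ... | inj₂ up = inj₁ (risen up ℕ.≤-refl)
  ... | inj₁ down = inj₂ (fallen down ℕ.≤-refl)

no-unit-gap : ∀ {m x y} → 2 ≤ m → x ≡ m + y → ¬ Consecutive x y
no-unit-gap {m} {x} {y} 2≤m x≡m+y (inj₁ x≡1+y) =
  ℕ.<-irrefl refl (subst (2 ≤_) (ℕ.+-cancelʳ-≡ y m 1 (trans (sym x≡m+y) x≡1+y)) 2≤m)
no-unit-gap {m} {x} {y} 2≤m x≡m+y (inj₂ y≡1+x) = ℕ.m≢1+n+m y (trans y≡1+x (cong suc x≡m+y))

saturate : ∀ m → ℕ → Fin (suc m)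
saturate m zero = zero
saturate zero (suc t) = zero
saturate (suc m) (suc t) = suc (saturate m t)

saturate-step : ∀ {m t} → t < m → ∃ λ (i : Fin m) → inject₁ i ≡ saturate m t × suc i ≡ saturate m (suc t)
saturate-step {suc m} {zero} _ = zero , refl , refl
saturate-step {suc m} {suc t} (s≤s t<m) with saturate-step t<m
... | i , p , q = suc i , cong suc p , cong suc q

saturate-top : ∀ m → saturate m m ≡ fromℕ m
saturate-top zero = refl
saturate-top (suc m) = cong suc (saturate-top m)

toℕ-saturate : ∀ {m t} → t ≤ m → toℕ (saturate m t) ≡ t
toℕ-saturate {m} {zero} _ = refl
toℕ-saturate {suc m} {suc t} (s≤s t≤m) = cong suc (toℕ-saturate t≤m)

cycle-vertices : ∀ {n m} {H : Subgraph n} {f : Fin (suc m) → Fin n} →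
  (∀ i → E H (f (inject₁ i)) (f (suc i)) ≡ true) → E H (f (fromℕ m)) (f zero) ≡ true →
  ∀ a → V H (f a) ≡ true
cycle-vertices {H = H} edges closing zero = E-V H _ _ (edge-sym {H = H} closing)
cycle-vertices {H = H} edges closing (suc i) = E-V H _ _ (edge-sym {H = H} (edges i))

-- Along a cycle the potential would be monotone, so the closing edge would span at least 2.
unitPotential⇒acyclic : ∀ {n} {H : Subgraph n} (φ : Fin n → ℕ) →
  (∀ {u v} → E H u v ≡ true → Consecutive (φ u) (φ v)) →
  (∀ {u v} → V H u ≡ true → V H v ≡ true → φ u ≡ φ v → u ≡ v) →
  ¬ Cycle H
unitPotential⇒acyclic {H = H} φ φ-step φ-injective (m , f , f-injective , 2≤m , edges , closing) =
  no-unit-gap-either (Zigzag.monotone g m unit-step no-backtrack (ℕ.<-trans (s≤s z≤n) 2≤m))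
  where
  g : ℕ → ℕ
  g t = φ (f (saturate m t))

  on-cycle : ∀ a → V H (f a) ≡ true
  on-cycle = cycle-vertices {H = H} edges closing

  unit-step : ∀ {t} → t < m → Consecutive (g t) (g (suc t))
  unit-step t<m with saturate-step t<m
  ... | i , p , q = subst₂ (λ a b → Consecutive (φ (f a)) (φ (f b))) p q (φ-step (edges i))

  no-backtrack : ∀ {t} → 2 + t ≤ m → g (2 + t) ≢ g t
  no-backtrack {t} 2+t≤m same = ℕ.m≢1+n+m t (sym (begin
    2 + t                      ≡⟨ toℕ-saturate 2+t≤m ⟨
    toℕ (saturate m (2 + t))   ≡⟨ cong toℕ (f-injective (φ-injective (on-cycle _) (on-cycle _) same)) ⟩
    toℕ (saturate m t)         ≡⟨ toℕ-saturate (ℕ.≤-trans (ℕ.m≤n+m t 2) 2+t≤m) ⟩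
    t                          ∎))
    where open ≡-Reasoning

  closing-step : Consecutive (g m) (g 0)
  closing-step rewrite saturate-top m = φ-step closing

  no-unit-gap-either : ¬ ((g m ≡ m + g 0) ⊎ (g 0 ≡ m + g m))
  no-unit-gap-either (inj₁ ascending) = no-unit-gap 2≤m ascending closing-step
  no-unit-gap-either (inj₂ descending) = no-unit-gap 2≤m descending (Sum.swap closing-step)

-- Paths

module _ {n : ℕ} where
  open import Data.List.Membership.DecPropositional (_≟_ {n}) using (_∈?_)

  -- Index of the first occurrence of x in xs (junk value: length xs if x ∉ xs).
  position : Fin n → List (Fin n) → ℕ
  position x [] = 0
  position x (y ∷ ys) = if does (x ≟ y) then 0 else suc (position x ys)

  position-head : ∀ y ys → position y (y ∷ ys) ≡ 0
  position-head y ys rewrite dec-true (y ≟ y) refl = refl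

  position-tail : ∀ {x y} ys → x ≢ y → position x (y ∷ ys) ≡ suc (position x ys)
  position-tail {x} {y} ys x≢y rewrite dec-false (x ≟ y) x≢y = refl

  position-injective : ∀ {x y} xs → x ∈ xs → y ∈ xs → position x xs ≡ position y xs → x ≡ y
  position-injective {x} {y} (z ∷ zs) x∈ y∈ eq with x ≟ z | y ≟ z
  ... | yes refl | yes refl = refl
  ... | yes _ | no _ = ⊥-elim (ℕ.0≢1+n eq)
  ... | no _ | yes _ = ⊥-elim (ℕ.0≢1+n (sym eq))
  ... | no x≢z | no y≢z = position-injective zs (∈-tail x≢z x∈) (∈-tail y≢z y∈) (ℕ.suc-injective eq)
    where
    ∈-tail : ∀ {w} → w ≢ z → w ∈ z ∷ zs → w ∈ zs
    ∈-tail w≢z (here w≡z) = ⊥-elim (w≢z w≡z)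
    ∈-tail w≢z (there w∈) = w∈

  PathEdge : List (Fin n) → Fin n → Fin n → Set
  PathEdge xs u v = u ∈ xs × v ∈ xs × Consecutive (position u xs) (position v xs)

  pathEdge? : ∀ xs u v → Dec (PathEdge xs u v)
  pathEdge? xs u v = u ∈? xs ×-dec v ∈? xs ×-dec
    (position u xs ℕ.≟ suc (position v xs) ⊎-dec position v xs ℕ.≟ suc (position u xs))

  pathGraph : List (Fin n) → Subgraph n
  pathGraph xs = record
    { V = λ x → does (x ∈? xs)
    ; E = λ u v → does (pathEdge? xs u v)
    ; E-sym = λ u v → does-⇔ (mk⇔ flip flip) (pathEdge? xs u v) (pathEdge? xs v u)
    ; E-irr = λ u → dec-false (pathEdge? xs u u) λ (_ , _ , c) → ℕ.1+n≢n (sym (Sum.reduce c))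
    ; E-V = λ u v e → dec-true (u ∈? xs) (proj₁ (witness (pathEdge? xs u v) e))
    }
    where
    flip : ∀ {u v} → PathEdge xs u v → PathEdge xs v u
    flip (u∈ , v∈ , c) = v∈ , u∈ , Sum.swap c

  private
    edge-cons : ∀ {y ys} → Unique (y ∷ ys) →
                ∀ u v → E (pathGraph ys) u v ≡ true → E (pathGraph (y ∷ ys)) u v ≡ true
    edge-cons {y} {ys} (y∉ys ∷ _) u v e with witness (pathEdge? ys u v) e
    ... | u∈ , v∈ , c = dec-true (pathEdge? (y ∷ ys) u v)
      (there u∈ , there v∈ ,
       subst₂ Consecutive (sym (position-tail ys (≢y u∈))) (sym (position-tail ys (≢y v∈)))
         (Sum.map (cong suc) (cong suc) c))
      where
      ≢y : ∀ {w} → w ∈ ys → w ≢ y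
      ≢y w∈ w≡y = All.lookup y∉ys w∈ (sym w≡y)

    edge-head : ∀ {y z zs} → Unique (y ∷ z ∷ zs) → E (pathGraph (y ∷ z ∷ zs)) y z ≡ true
    edge-head {y} {z} {zs} ((y≢z ∷ _) ∷ _) =
      dec-true (pathEdge? (y ∷ z ∷ zs) y z) (here refl , there (here refl) , inj₂ (begin
        position z (y ∷ z ∷ zs)      ≡⟨ position-tail (z ∷ zs) (y≢z ∘ sym) ⟩
        suc (position z (z ∷ zs))    ≡⟨ cong suc (position-head z zs) ⟩
        1                            ≡⟨ cong suc (position-head y (z ∷ zs)) ⟨
        suc (position y (y ∷ z ∷ zs)) ∎))
      where open ≡-Reasoning

    walk-from-head : ∀ {y ys x} → Unique (y ∷ ys) → x ∈ y ∷ ys → Walk (pathGraph (y ∷ ys)) y x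
    walk-from-head _ (here refl) = here
    walk-from-head {ys = z ∷ zs} u (there x∈) =
      step (edge-head u) (walk-map id (edge-cons u) (walk-from-head (AllPairs.tail u) x∈))

  pathGraph-connected : ∀ {xs} → Unique xs → Connected (pathGraph xs)
  pathGraph-connected {y ∷ ys} u a b a∈ b∈ =
    reverse (walk-from-head u (witness (a ∈? _) a∈)) ◅◅ walk-from-head u (witness (b ∈? _) b∈)

  pathGraph-acyclic : ∀ xs → ¬ Cycle (pathGraph xs)
  pathGraph-acyclic xs = unitPotential⇒acyclic {H = pathGraph xs} (λ u → position u xs)
    (λ {u} {v} e → proj₂ (proj₂ (witness (pathEdge? xs u v) e)))
    (λ {u} {v} u∈ v∈ → position-injective xs (witness (u ∈? xs) u∈) (witness (v ∈? xs) v∈))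

  pathGraph-isTree : ∀ {xs} → Unique xs → IsTree (pathGraph xs)
  pathGraph-isTree {xs} u = pathGraph-connected u , pathGraph-acyclic xs

-- Images of subgraphs under embeddings

TwoDisjointProperTrees : ∀ {k n} → Coloring k n → Fin n → Fin n → Fin n → Set
TwoDisjointProperTrees {n = n} χ a b c =
  Σ (Subgraph n) λ T₁ → Σ (Subgraph n) λ T₂ →
    IsSTree a b c T₁ × IsSTree a b c T₂ ×
    IsProper χ T₁ × IsProper χ T₂ ×
    InternallyDisjoint a b c T₁ T₂

module Image {K n} (e : Fin K → Fin n) (e-injective : Injective _≡_ _≡_ e) where

  VertexImage : Subgraph K → Fin n → Set
  VertexImage H x = ∃ λ i → e i ≡ x × V H i ≡ true

  EdgeImage : Subgraph K → Fin n → Fin n → Set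
  EdgeImage H u v = ∃₂ λ i j → e i ≡ u × e j ≡ v × E H i j ≡ true

  vertexImage? : ∀ H x → Dec (VertexImage H x)
  vertexImage? H x = any? λ i → e i ≟ x ×-dec V H i Bool.≟ true

  edgeImage? : ∀ H u v → Dec (EdgeImage H u v)
  edgeImage? H u v = any? λ i → any? λ j → e i ≟ u ×-dec e j ≟ v ×-dec E H i j Bool.≟ true

  image : Subgraph K → Subgraph n
  image H = record
    { V = λ x → does (vertexImage? H x)
    ; E = λ u v → does (edgeImage? H u v)
    ; E-sym = λ u v → does-⇔ (mk⇔ flip flip) (edgeImage? H u v) (edgeImage? H v u)
    ; E-irr = λ u → dec-false (edgeImage? H u u) loop-free
    ; E-V = λ u v uv → let (i , j , eᵢ≡u , _ , ij) = witness (edgeImage? H u v) uv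
                       in dec-true (vertexImage? H u) (i , eᵢ≡u , E-V H i j ij)
    }
    where
    flip : ∀ {u v} → EdgeImage H u v → EdgeImage H v u
    flip (i , j , p , q , ij) = j , i , q , p , trans (E-sym H j i) ij

    loop-free : ∀ {u} → ¬ EdgeImage H u u
    loop-free (i , j , refl , eⱼ≡eᵢ , ij) with e-injective eⱼ≡eᵢ
    ... | refl = Bool.not-¬ (E-irr H i) ij

  module _ {H : Subgraph K} where

    image-vertex : ∀ {i} → V H i ≡ true → V (image H) (e i) ≡ true
    image-vertex {i} Vi = dec-true (vertexImage? H (e i)) (i , refl , Vi)

    image-edge : ∀ {i j} → E H i j ≡ true → E (image H) (e i) (e j) ≡ true
    image-edge {i} {j} ij = dec-true (edgeImage? H (e i) (e j)) (i , j , refl , refl , ij)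

    image-vertex⁻¹ : ∀ {x} → V (image H) x ≡ true → VertexImage H x
    image-vertex⁻¹ {x} = witness (vertexImage? H x)

    image-edge⁻¹ : ∀ {u v} → E (image H) u v ≡ true → EdgeImage H u v
    image-edge⁻¹ {u} {v} = witness (edgeImage? H u v)

    vertex-reflected : ∀ {i} → V (image H) (e i) ≡ true → V H i ≡ true
    vertex-reflected Vei with image-vertex⁻¹ Vei
    ... | i′ , eᵢ′≡eᵢ , Vi′ with e-injective eᵢ′≡eᵢ
    ... | refl = Vi′

    edge-reflected : ∀ {i j} → E (image H) (e i) (e j) ≡ true → E H i j ≡ true
    edge-reflected Eeij with image-edge⁻¹ Eeij
    ... | i′ , j′ , p , q , i′j′ with e-injective p | e-injective q
    ... | refl | refl = i′j′

    image-edge-absent : ∀ {i j} → E H i j ≡ false → E (image H) (e i) (e j) ≡ false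
    image-edge-absent {i} {j} ij =
      dec-false (edgeImage? H (e i) (e j)) (Bool.not-¬ ij ∘ edge-reflected ∘ dec-true (edgeImage? H (e i) (e j)))

    image-connected : Connected H → Connected (image H)
    image-connected connected u v Vu Vv with image-vertex⁻¹ Vu | image-vertex⁻¹ Vv
    ... | i , refl , Vi | j , refl , Vj = walk-map e (λ _ _ → image-edge) (connected i j Vi Vj)

    -- The cycle pulls back along e: each of its vertices lies in the image.
    image-acyclic : ¬ Cycle H → ¬ Cycle (image H)
    image-acyclic acyclic (m , f , f-injective , 2≤m , edges , closing) =
      acyclic (m , pre , pre-injective , 2≤m , edges′ , closing′)
      where
      on-cycle : ∀ a → VertexImage H (f a)
      on-cycle a = image-vertex⁻¹ (cycle-vertices {H = image H} edges closing a)

      pre : Fin (suc m) → Fin K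
      pre a = proj₁ (on-cycle a)

      e∘pre : ∀ a → e (pre a) ≡ f a
      e∘pre a = proj₁ (proj₂ (on-cycle a))

      pre-injective : Injective _≡_ _≡_ pre
      pre-injective {a} {b} p = f-injective (trans (sym (e∘pre a)) (trans (cong e p) (e∘pre b)))

      pulled : ∀ {a b} → E (image H) (f a) (f b) ≡ true → E H (pre a) (pre b) ≡ true
      pulled {a} {b} fab = edge-reflected (subst₂ (λ u v → E (image H) u v ≡ true) (sym (e∘pre a)) (sym (e∘pre b)) fab)

      edges′ : ∀ i → E H (pre (inject₁ i)) (pre (suc i)) ≡ true
      edges′ i = pulled (edges i)

      closing′ : E H (pre (fromℕ m)) (pre zero) ≡ true
      closing′ = pulled closing

    image-isTree : IsTree H → IsTree (image H)
    image-isTree (connected , acyclic) = image-connected connected , image-acyclic acyclic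

    image-isSTree : ∀ {a b c} → IsSTree a b c H → IsSTree (e a) (e b) (e c) (image H)
    image-isSTree (tree , Va , Vb , Vc) = image-isTree tree , image-vertex Va , image-vertex Vb , image-vertex Vc

    image-proper : ∀ {k} {χ : Coloring k K} {χ′ : Coloring k n} →
      (∀ i j → col χ′ (e i) (e j) ≡ col χ i j) → IsProper χ H → IsProper χ′ (image H)
    image-proper preserves proper u v w uv uw v≢w with image-edge⁻¹ uv | image-edge⁻¹ uw
    ... | i , j , refl , refl , ij | i′ , l , eᵢ′≡eᵢ , refl , i′l with e-injective eᵢ′≡eᵢ
    ... | refl = λ same → proper i j l ij i′l (v≢w ∘ cong e)
                   (trans (sym (preserves i j)) (trans same (preserves i l)))

  image-disjoint : ∀ {a b c H₁ H₂} → InternallyDisjoint a b c H₁ H₂ →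
    InternallyDisjoint (e a) (e b) (e c) (image H₁) (image H₂)
  image-disjoint {a} {b} {c} {H₁} {H₂} (edge-disjoint , vertex-disjoint) = edge-disjoint′ , vertex-disjoint′
    where
    edge-disjoint′ : ∀ u v → E (image H₁) u v ≡ true → E (image H₂) u v ≡ false
    edge-disjoint′ u v uv with image-edge⁻¹ {H = H₁} uv
    ... | i , j , refl , refl , ij = image-edge-absent {H = H₂} (edge-disjoint i j ij)

    vertex-disjoint′ : ∀ x → V (image H₁) x ≡ true → V (image H₂) x ≡ true → InS (e a) (e b) (e c) x
    vertex-disjoint′ x V₁x V₂x with image-vertex⁻¹ {H = H₁} V₁x
    ... | i , refl , V₁i = Sum.map (cong e) (Sum.map (cong e) (cong e)) (vertex-disjoint i V₁i (vertex-reflected {H = H₂} V₂x))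

  image-twoTrees : ∀ {k} {χ : Coloring k K} {χ′ : Coloring k n} →
    (∀ i j → col χ′ (e i) (e j) ≡ col χ i j) →
    ∀ {a b c} → TwoDisjointProperTrees χ a b c → TwoDisjointProperTrees χ′ (e a) (e b) (e c)
  image-twoTrees {χ = χ} {χ′} preserves {a} {b} {c} (T₁ , T₂ , S₁ , S₂ , proper₁ , proper₂ , disjoint) =
    image T₁ , image T₂ , image-isSTree {H = T₁} S₁ , image-isSTree {H = T₂} S₂ ,
    image-proper {H = T₁} {χ = χ} {χ′} preserves proper₁ ,
    image-proper {H = T₂} {χ = χ} {χ′} preserves proper₂ ,
    image-disjoint {a} {b} {c} {T₁} {T₂} disjoint

-- The colouring

blue red : Fin 2
blue = zero
red = suc zero

coreColour : Fin 4 → Fin 4 → Fin 2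
coreColour zero (suc (suc (suc zero))) = red
coreColour (suc (suc (suc zero))) zero = red
coreColour (suc (suc (suc zero))) (suc (suc zero)) = red
coreColour (suc (suc zero)) (suc (suc (suc zero))) = red
coreColour (suc (suc zero)) (suc zero) = red
coreColour (suc zero) (suc (suc zero)) = red
coreColour _ _ = blue

coreColour-sym : ∀ s t → coreColour s t ≡ coreColour t s
coreColour-sym = toWitness {a? = all? λ s → all? λ t → coreColour s t ≟ coreColour t s} _

-- splitAt 4 separates the vertices of K_{4+m} into the core K₄ and m extra vertices.
colour : ∀ {m} → Fin 4 ⊎ Fin m → Fin 4 ⊎ Fin m → Fin 2
colour (inj₁ s) (inj₁ t) = coreColour s t
colour (inj₂ _) (inj₂ _) = red
colour _ _ = blue

colour-sym : ∀ {m} (x y : Fin 4 ⊎ Fin m) → colour x y ≡ colour y x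
colour-sym (inj₁ s) (inj₁ t) = coreColour-sym s t
colour-sym (inj₁ _) (inj₂ _) = refl
colour-sym (inj₂ _) (inj₁ _) = refl
colour-sym (inj₂ _) (inj₂ _) = refl

colour-map₂ : ∀ {k m} (f : Fin k → Fin m) x y → colour (Sum.map₂ f x) (Sum.map₂ f y) ≡ colour x y
colour-map₂ f (inj₁ _) (inj₁ _) = refl
colour-map₂ f (inj₁ _) (inj₂ _) = refl
colour-map₂ f (inj₂ _) (inj₁ _) = refl
colour-map₂ f (inj₂ _) (inj₂ _) = refl

colouring : ∀ m → Coloring 2 (4 + m)
colouring m = record
  { col = λ u v → colour (splitAt 4 u) (splitAt 4 v)
  ; col-sym = λ u v → colour-sym (splitAt 4 u) (splitAt 4 v)
  }

extend : ∀ {k m} → Vec (Fin m) k → Fin (4 + k) → Fin (4 + m)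
extend {m = m} ys = join 4 m ∘ Sum.map₂ (lookup ys) ∘ splitAt 4

splitAt-extend : ∀ {k m} (ys : Vec (Fin m) k) x → splitAt 4 (extend ys x) ≡ Sum.map₂ (lookup ys) (splitAt 4 x)
splitAt-extend {m = m} ys x = splitAt-join 4 m (Sum.map₂ (lookup ys) (splitAt 4 x))

extend-injective : ∀ {k m} {ys : Vec (Fin m) k} → VecUnique.Unique ys → Injective _≡_ _≡_ (extend ys)
extend-injective {ys = ys} unique {x} {y} eq = begin
  x                     ≡⟨ join-splitAt 4 _ x ⟨
  join 4 _ (splitAt 4 x) ≡⟨ cong (join 4 _) (map₂-injective (splitAt 4 x) (splitAt 4 y) (begin
      Sum.map₂ (lookup ys) (splitAt 4 x) ≡⟨ splitAt-extend ys x ⟨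
      splitAt 4 (extend ys x)             ≡⟨ cong (splitAt 4) eq ⟩
      splitAt 4 (extend ys y)             ≡⟨ splitAt-extend ys y ⟩
      Sum.map₂ (lookup ys) (splitAt 4 y)  ∎)) ⟩
  join 4 _ (splitAt 4 y) ≡⟨ join-splitAt 4 _ y ⟩
  y                     ∎
  where
  open ≡-Reasoning
  map₂-injective : ∀ (s t : Fin 4 ⊎ _) → Sum.map₂ (lookup ys) s ≡ Sum.map₂ (lookup ys) t → s ≡ t
  map₂-injective (inj₁ _) (inj₁ _) p = cong inj₁ (inj₁-injective p)
  map₂-injective (inj₂ i) (inj₂ j) p = cong inj₂ (lookup-injective unique i j (inj₂-injective p))

extend-preserves-colour : ∀ {k m} (ys : Vec (Fin m) k) x y →
  col (colouring m) (extend ys x) (extend ys y) ≡ col (colouring k) x y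
extend-preserves-colour ys x y rewrite splitAt-extend ys x | splitAt-extend ys y =
  colour-map₂ (lookup ys) (splitAt 4 x) (splitAt 4 y)

extend-core : ∀ {k m} (ys : Vec (Fin m) k) s → extend ys (s ↑ˡ k) ≡ s ↑ˡ m
extend-core {k} ys s rewrite splitAt-↑ˡ 4 s k = refl

data Vertex (m : ℕ) : Fin (4 + m) → Set where
  core : (s : Fin 4) → Vertex m (s ↑ˡ m)
  extra : (y : Fin m) → Vertex m (4 ↑ʳ y)

vertex : ∀ {m} x → Vertex m x
vertex {m} x with splitAt 4 x in eq
... | inj₁ s = subst (Vertex m) (splitAt⁻¹-↑ˡ eq) (core s)
... | inj₂ y = subst (Vertex m) (splitAt⁻¹-↑ʳ eq) (extra y)

-- A colour-preserving copy of K_{4+k} in K_{4+m} that contains S = {a, b, c} and whose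
-- extra vertices all lie in S.
record Localisation {m} (a b c : Fin (4 + m)) : Set where
  constructor localisation
  field
    {k} : ℕ
    extras : Vec (Fin m) k
    extras-unique : VecUnique.Unique extras
    k≤3 : k ≤ 3
    a′ b′ c′ : Fin (4 + k)
    a′↦a : extend extras a′ ≡ a
    b′↦b : extend extras b′ ≡ b
    c′↦c : extend extras c′ ≡ c
    covers : ∀ j → InS a′ b′ c′ (4 ↑ʳ j)

localise : ∀ {m} {a b c : Fin (4 + m)} → a ≢ b → a ≢ c → b ≢ c → Localisation a b c
localise {a = a} {b} {c} a≢b a≢c b≢c with vertex a | vertex b | vertex c
... | core s | core t | core u =
  localisation [] [] z≤n (s ↑ˡ 0) (t ↑ˡ 0) (u ↑ˡ 0) (extend-core [] s) (extend-core [] t) (extend-core [] u) λ ()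
... | extra x | core t | core u =
  localisation (x ∷ []) ([] ∷ []) (s≤s z≤n) (4 ↑ʳ zero) (t ↑ˡ 1) (u ↑ˡ 1)
    refl (extend-core (x ∷ []) t) (extend-core (x ∷ []) u) λ { zero → inj₁ refl }
... | core s | extra y | core u =
  localisation (y ∷ []) ([] ∷ []) (s≤s z≤n) (s ↑ˡ 1) (4 ↑ʳ zero) (u ↑ˡ 1)
    (extend-core (y ∷ []) s) refl (extend-core (y ∷ []) u) λ { zero → inj₂ (inj₁ refl) }
... | core s | core t | extra z =
  localisation (z ∷ []) ([] ∷ []) (s≤s z≤n) (s ↑ˡ 1) (t ↑ˡ 1) (4 ↑ʳ zero)
    (extend-core (z ∷ []) s) (extend-core (z ∷ []) t) refl λ { zero → inj₂ (inj₂ refl) }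
... | core s | extra y | extra z =
  localisation (y ∷ z ∷ []) (((b≢c ∘ cong (4 ↑ʳ_)) ∷ []) ∷ [] ∷ []) (s≤s (s≤s z≤n))
    (s ↑ˡ 2) (4 ↑ʳ zero) (4 ↑ʳ suc zero) (extend-core (y ∷ z ∷ []) s) refl refl
    λ { zero → inj₂ (inj₁ refl) ; (suc zero) → inj₂ (inj₂ refl) }
... | extra x | core t | extra z =
  localisation (x ∷ z ∷ []) (((a≢c ∘ cong (4 ↑ʳ_)) ∷ []) ∷ [] ∷ []) (s≤s (s≤s z≤n))
    (4 ↑ʳ zero) (t ↑ˡ 2) (4 ↑ʳ suc zero) refl (extend-core (x ∷ z ∷ []) t) refl
    λ { zero → inj₁ refl ; (suc zero) → inj₂ (inj₂ refl) }
... | extra x | extra y | core u =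
  localisation (x ∷ y ∷ []) (((a≢b ∘ cong (4 ↑ʳ_)) ∷ []) ∷ [] ∷ []) (s≤s (s≤s z≤n))
    (4 ↑ʳ zero) (4 ↑ʳ suc zero) (u ↑ˡ 2) refl refl (extend-core (x ∷ y ∷ []) u)
    λ { zero → inj₁ refl ; (suc zero) → inj₂ (inj₁ refl) }
... | extra x | extra y | extra z =
  localisation (x ∷ y ∷ z ∷ [])
    (((a≢b ∘ cong (4 ↑ʳ_)) ∷ (a≢c ∘ cong (4 ↑ʳ_)) ∷ []) ∷ ((b≢c ∘ cong (4 ↑ʳ_)) ∷ []) ∷ [] ∷ [])
    (s≤s (s≤s (s≤s z≤n))) (4 ↑ʳ zero) (4 ↑ʳ suc zero) (4 ↑ʳ suc (suc zero)) refl refl refl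
    λ { zero → inj₁ refl ; (suc zero) → inj₂ (inj₁ refl) ; (suc (suc zero)) → inj₂ (inj₂ refl) }

-- Certified pairs of paths

module _ {n : ℕ} where
  open import Data.List.Membership.DecPropositional (_≟_ {n}) using (_∈?_)
  open import Data.List.Relation.Unary.Unique.DecPropositional (_≟_ {n}) using (unique?)

  proper? : ∀ {k} (χ : Coloring k n) H → Dec (IsProper χ H)
  proper? χ H = all? λ u → all? λ v → all? λ w →
    (E H u v Bool.≟ true) →-dec (E H u w Bool.≟ true) →-dec ¬? (v ≟ w) →-dec
    ¬? (col χ u v ≟ col χ u w)

  disjoint? : ∀ (a b c : Fin n) H₁ H₂ → Dec (InternallyDisjoint a b c H₁ H₂)
  disjoint? a b c H₁ H₂ =
    (all? λ u → all? λ v → (E H₁ u v Bool.≟ true) →-dec (E H₂ u v Bool.≟ false)) ×-dec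
    (all? λ x → (V H₁ x Bool.≟ true) →-dec (V H₂ x Bool.≟ true) →-dec
                (x ≟ a ⊎-dec x ≟ b ⊎-dec x ≟ c))

  ThroughAll : Fin n → Fin n → Fin n → List (Fin n) → Set
  ThroughAll a b c xs = a ∈ xs × b ∈ xs × c ∈ xs

  throughAll? : ∀ a b c xs → Dec (ThroughAll a b c xs)
  throughAll? a b c xs = a ∈? xs ×-dec b ∈? xs ×-dec c ∈? xs

  Certificate : ∀ {k} → Coloring k n → Fin n → Fin n → Fin n → List (Fin n) × List (Fin n) → Set
  Certificate χ a b c (xs , ys) =
    Unique xs × Unique ys × ThroughAll a b c xs × ThroughAll a b c ys ×
    IsProper χ (pathGraph xs) × IsProper χ (pathGraph ys) ×
    InternallyDisjoint a b c (pathGraph xs) (pathGraph ys)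

  certificate? : ∀ {k} (χ : Coloring k n) a b c xys → Dec (Certificate χ a b c xys)
  certificate? χ a b c (xs , ys) =
    unique? xs ×-dec unique? ys ×-dec throughAll? a b c xs ×-dec throughAll? a b c ys ×-dec
    proper? χ (pathGraph xs) ×-dec proper? χ (pathGraph ys) ×-dec
    disjoint? a b c (pathGraph xs) (pathGraph ys)

  certificate⇒twoTrees : ∀ {k} {χ : Coloring k n} {a b c} xys →
    Certificate χ a b c xys → TwoDisjointProperTrees χ a b c
  certificate⇒twoTrees {a = a} {b} {c} (xs , ys) (xs-unique , ys-unique , xs-S , ys-S , xs-proper , ys-proper , disjoint) =
    pathGraph xs , pathGraph ys , sTree xs xs-unique xs-S , sTree ys ys-unique ys-S ,
    xs-proper , ys-proper , disjoint
    where
    sTree : ∀ zs → Unique zs → ThroughAll a b c zs → IsSTree a b c (pathGraph zs)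
    sTree zs unique (a∈ , b∈ , c∈) =
      pathGraph-isTree unique , dec-true (a ∈? zs) a∈ , dec-true (b ∈? zs) b∈ , dec-true (c ∈? zs) c∈

-- The key of S = {a, b, c} is its characteristic bit mask.
key : ∀ {n} → Fin n → Fin n → Fin n → ℕ
key a b c = 2 ^ toℕ a + 2 ^ toℕ b + 2 ^ toℕ c

pathPairs : ∀ k → List (ℕ × List (Fin (4 + k)) × List (Fin (4 + k)))
pathPairs 0 =
  (7  , (# 0 ∷ # 1 ∷ # 2 ∷ []) , (# 0 ∷ # 2 ∷ # 3 ∷ # 1 ∷ [])) ∷
  (11 , (# 1 ∷ # 0 ∷ # 3 ∷ []) , (# 0 ∷ # 2 ∷ # 1 ∷ # 3 ∷ [])) ∷
  (13 , (# 0 ∷ # 2 ∷ # 3 ∷ []) , (# 0 ∷ # 3 ∷ # 1 ∷ # 2 ∷ [])) ∷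
  (14 , (# 1 ∷ # 3 ∷ # 2 ∷ []) , (# 1 ∷ # 2 ∷ # 0 ∷ # 3 ∷ [])) ∷ []
pathPairs 1 =
  (19 , (# 0 ∷ # 1 ∷ # 2 ∷ # 4 ∷ []) , (# 1 ∷ # 3 ∷ # 0 ∷ # 4 ∷ [])) ∷
  (21 , (# 0 ∷ # 1 ∷ # 2 ∷ # 4 ∷ []) , (# 0 ∷ # 2 ∷ # 3 ∷ # 4 ∷ [])) ∷
  (25 , (# 3 ∷ # 0 ∷ # 4 ∷ []) , (# 0 ∷ # 2 ∷ # 3 ∷ # 4 ∷ [])) ∷
  (22 , (# 2 ∷ # 1 ∷ # 4 ∷ []) , (# 1 ∷ # 3 ∷ # 2 ∷ # 4 ∷ [])) ∷
  (26 , (# 1 ∷ # 0 ∷ # 3 ∷ # 4 ∷ []) , (# 1 ∷ # 3 ∷ # 2 ∷ # 4 ∷ [])) ∷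
  (28 , (# 2 ∷ # 3 ∷ # 4 ∷ []) , (# 3 ∷ # 1 ∷ # 2 ∷ # 4 ∷ [])) ∷ []
pathPairs 2 =
  (49 , (# 0 ∷ # 4 ∷ # 5 ∷ []) , (# 4 ∷ # 3 ∷ # 0 ∷ # 5 ∷ [])) ∷
  (50 , (# 1 ∷ # 4 ∷ # 5 ∷ []) , (# 4 ∷ # 2 ∷ # 1 ∷ # 5 ∷ [])) ∷
  (52 , (# 2 ∷ # 4 ∷ # 5 ∷ []) , (# 4 ∷ # 1 ∷ # 2 ∷ # 5 ∷ [])) ∷
  (56 , (# 3 ∷ # 4 ∷ # 5 ∷ []) , (# 4 ∷ # 0 ∷ # 3 ∷ # 5 ∷ [])) ∷ []
pathPairs 3 =
  (112 , (# 4 ∷ # 0 ∷ # 3 ∷ # 5 ∷ # 6 ∷ []) , (# 4 ∷ # 5 ∷ # 1 ∷ # 2 ∷ # 6 ∷ [])) ∷ []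
pathPairs _ = []

pathPair : ∀ {k} → Fin (4 + k) → Fin (4 + k) → Fin (4 + k) → List (Fin (4 + k)) × List (Fin (4 + k))
pathPair {k} a b c = maybe proj₂ ([] , []) (findᵇ ((key a b c ≡ᵇ_) ∘ proj₁) (pathPairs k))

Certified : ℕ → Set
Certified k = ∀ a b c → a ≢ b → a ≢ c → b ≢ c → (∀ j → InS a b c (4 ↑ʳ j)) →
  Certificate (colouring k) a b c (pathPair a b c)

certified? : ∀ k → Dec (Certified k)
certified? k = all? λ a → all? λ b → all? λ c →
  ¬? (a ≟ b) →-dec ¬? (a ≟ c) →-dec ¬? (b ≟ c) →-dec
  all? (λ j → 4 ↑ʳ j ≟ a ⊎-dec 4 ↑ʳ j ≟ b ⊎-dec 4 ↑ʳ j ≟ c) →-dec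
  certificate? (colouring k) a b c (pathPair a b c)

certified : ∀ k → k ≤ 3 → Certified k
certified 0 _ = toWitness {a? = certified? 0} _
certified 1 _ = toWitness {a? = certified? 1} _
certified 2 _ = toWitness {a? = certified? 2} _
certified 3 _ = toWitness {a? = certified? 3} _
certified (suc (suc (suc (suc _)))) (s≤s (s≤s (s≤s ())))

colouring-good : ∀ m → Good32 (colouring m)
colouring-good m a b c a≢b a≢c b≢c with localise a≢b a≢c b≢c
... | localisation {k} extras extras-unique k≤3 a′ b′ c′ refl refl refl covers =
  Image.image-twoTrees (extend extras) (extend-injective extras-unique)
    {χ = colouring k} {colouring m} (extend-preserves-colour extras)
    (certificate⇒twoTrees {χ = colouring k} (pathPair a′ b′ c′)
      (certified k k≤3 a′ b′ c′ (a≢b ∘ cong (extend extras)) (a≢c ∘ cong (extend extras))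
        (b≢c ∘ cong (extend extras)) covers))

-- One colour is not enough

module _ {n} (χ : Coloring 1 n) {T : Subgraph n} (proper : IsProper χ T) where

  neighbour-unique : ∀ {u v w} → E T u v ≡ true → E T u w ≡ true → v ≡ w
  neighbour-unique {u} {v} {w} uv uw with v ≟ w
  ... | yes v≡w = v≡w
  ... | no v≢w = ⊥-elim (proper u v w uv uw v≢w (single (col χ u v) (col χ u w)))
    where
    single : ∀ (i j : Fin 1) → i ≡ j
    single zero zero = refl

  walk-stays : ∀ {a v x y} → E T a v ≡ true → x ≡ a ⊎ x ≡ v → Walk T x y → y ≡ a ⊎ y ≡ v
  walk-stays av x∈ here = x∈
  walk-stays av (inj₁ refl) (step aw p) = walk-stays av (inj₂ (neighbour-unique aw av)) p
  walk-stays av (inj₂ refl) (step vw p) = walk-stays av (inj₁ (neighbour-unique vw (edge-sym {H = T} av))) p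

  at-most-two-vertices : Connected T → ∀ {a b c} → V T a ≡ true → V T b ≡ true → V T c ≡ true →
    a ≢ b → a ≢ c → b ≡ c
  at-most-two-vertices connected {a} {b} {c} Va Vb Vc a≢b a≢c with connected a b Va Vb
  ... | here = ⊥-elim (a≢b refl)
  ... | step {v = v} av p = trans (other (walk-stays av (inj₁ refl) (step av p)) (a≢b ∘ sym))
                                  (sym (other (walk-stays av (inj₁ refl) (connected a c Va Vc)) (a≢c ∘ sym)))
    where
    other : ∀ {x} → x ≡ a ⊎ x ≡ v → x ≢ a → x ≡ v
    other (inj₁ x≡a) x≢a = ⊥-elim (x≢a x≡a)
    other (inj₂ x≡v) _ = x≡v

one-colour-not-good : ∀ {m} (χ : Coloring 1 (3 + m)) → ¬ Good32 χ
one-colour-not-good χ good with good zero (suc zero) (suc (suc zero)) (λ ()) (λ ()) (λ ())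
... | T , _ , ((connected , _) , Va , Vb , Vc) , _ , proper , _ =
  contradiction (at-most-two-vertices χ proper connected Va Vb Vc (λ ()) (λ ())) λ ()

theorem2p4 : ∀ (n : ℕ) → 4 ≤ n → px32-K≡ n 2
theorem2p4 (suc (suc (suc (suc m)))) (s≤s (s≤s (s≤s (s≤s z≤n)))) = (colouring m , colouring-good m) , fewer
  where
  fewer : ∀ j → j < 2 → ¬ Σ (Coloring j (4 + m)) Good32
  fewer zero _ (χ , _) = ¬Fin0 (col χ zero zero)
  fewer (suc zero) _ (χ , good) = one-colour-not-good χ good
  fewer (suc (suc _)) (s≤s (s≤s ()))
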